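{- There is a constant $c$ such that for each positive integer $n$ there is an existential formula $\theta_n(g,x)$ in the first-order language of monoids $L(e,\circ)$ with $|\theta_n|\le c\log n$ such that for every monoid $M$ and all $g,x\in M$: $M\models\theta_n(g,x)$ if and only if $x^n=g$.
   Context: $|\theta|$ is the number of symbols of the formula, each variable counting as one symbol. Here $\log m=\min\{r\in\mathbb N:2^r\ge m\}$. -}

module Defs where

open import Level using (Level; _⊔_; Setω)
open import Data.Nat using (ℕ; zero; suc; _+_; _*_; _≤_) renaming (_⊔_ to _⊔ℕ_)
open import Data.Nat.Logarithm using (⌈log₂_⌉)
open import Data.Fin using (Fin)
open import Data.Product using (Σ; _×_)
open import Data.Sum using (_⊎_)
open import Relation.Nullary using (¬_)
open import Function.Bundles using (_⇔_)
open import Algebra.Bundles using (Monoid)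

data Term (n : ℕ) : Set where
  var : Fin n → Term n
  e   : Term n
  _∘_ : Term n → Term n → Term n

data QF (n : ℕ) : Set where
  _≐_  : Term n → Term n → QF n
  ¬′_  : QF n → QF n
  _∧′_ : QF n → QF n → QF n
  _∨′_ : QF n → QF n → QF n

-- Existential formulas: ∃y₁ … ∃yₖ φ with φ quantifier-free.
-- ∃′ binds a new variable (index 0 in the body).
data ExFormula (n : ℕ) : Set where
  qf : QF n → ExFormula n
  ∃′ : ExFormula (suc n) → ExFormula n

-- Number of symbols; each variable occurrence counts as one symbol,
-- e, ∘, =, ¬, ∧, ∨ each count one, and a quantifier "∃y" counts two
-- (the quantifier symbol and the bound variable).  Polish notation,
-- so no parentheses are needed.
termSize : ∀ {n} → Term n → ℕ
termSize (var _) = 1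
termSize e       = 1
termSize (t ∘ s) = 1 + termSize t + termSize s

qfSize : ∀ {n} → QF n → ℕ
qfSize (t ≐ s)  = 1 + termSize t + termSize s
qfSize (¬′ φ)   = 1 + qfSize φ
qfSize (φ ∧′ ψ) = 1 + qfSize φ + qfSize ψ
qfSize (φ ∨′ ψ) = 1 + qfSize φ + qfSize ψ

size : ∀ {n} → ExFormula n → ℕ
size (qf φ) = qfSize φ
size (∃′ φ) = 2 + size φ

module Semantics {a ℓ : Level} (M : Monoid a ℓ) where
  open Monoid M

  Env : ℕ → Set a
  Env n = Fin n → Carrier

  extend : ∀ {n} → Carrier → Env n → Env (suc n)
  extend y ρ Fin.zero    = y
  extend y ρ (Fin.suc i) = ρ i

  ⟦_⟧ : ∀ {n} → Term n → Env n → Carrier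
  ⟦ var i ⟧ ρ = ρ i
  ⟦ e ⟧     ρ = ε
  ⟦ t ∘ s ⟧ ρ = ⟦ t ⟧ ρ ∙ ⟦ s ⟧ ρ

  SatQF : ∀ {n} → QF n → Env n → Set ℓ
  SatQF (t ≐ s)  ρ = ⟦ t ⟧ ρ ≈ ⟦ s ⟧ ρ
  SatQF (¬′ φ)   ρ = ¬ SatQF φ ρ
  SatQF (φ ∧′ ψ) ρ = SatQF φ ρ × SatQF ψ ρ
  SatQF (φ ∨′ ψ) ρ = SatQF φ ρ ⊎ SatQF ψ ρ

  Sat : ∀ {n} → ExFormula n → Env n → Set (a ⊔ ℓ)
  Sat (qf φ) ρ = Level.Lift a (SatQF φ ρ)
  Sat (∃′ φ) ρ = Σ Carrier λ y → Sat φ (extend y ρ)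

  pow : Carrier → ℕ → Carrier
  pow x zero    = ε
  pow x (suc n) = x ∙ pow x n

  env₂ : Carrier → Carrier → Env 2
  env₂ g x Fin.zero            = g
  env₂ g x (Fin.suc Fin.zero)  = x

DefinesPower : ℕ → ExFormula 2 → Setω
DefinesPower n θ = ∀ {a ℓ} (M : Monoid a ℓ) (g x : Monoid.Carrier M) →
  let open Semantics M in
  Sat θ (env₂ g x) ⇔ (Monoid._≈_ M (pow x n) g)

record GoodFormula (c n : ℕ) : Setω where
  field
    θ          : ExFormula 2
    size-bound : size θ ≤ c * (1 ⊔ℕ ⌈log₂ n ⌉)
    defines    : DefinesPower n θ

record ∃-constant (P : ℕ → Setω) : Setω where
  constructor _,_
  field
    c     : ℕ
    holds : P c

-- In any monoid, xᵐ = g iff ∃y. y = x^⌊m/2⌋ ∧ g = y·y·x^(m mod 2).  Unfolding this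
-- recursion once per binary digit of m, and pulling each new ∃ in front of the
-- conjunction built so far, gives a prenex existential formula that spends one
-- quantifier and one equation of constant size per digit.  Since m < 2^(1 + ⌈log₂ m⌉),
-- that is O(log m) symbols.
module Submission where

open import Defs
open import Data.Nat using (ℕ; _≤_)

open import Level using (lift)
open import Data.Nat using (zero; suc; _+_; _*_; _^_; _<_; z≤n; s≤s; ⌊_/2⌋; ⌈_/2⌉; parity; >-nonZero)
  renaming (_⊔_ to _⊔ℕ_)
open import Data.Nat.Properties
open import Data.Nat.Logarithm using (⌈log₂_⌉)
open import Data.Nat.Logarithm.Core using (⌈log2⌉)
open import Data.Nat.Induction using (<-wellFounded)
open import Induction.WellFounded using (Acc; acc)
open import Data.Parity.Base using (Parity; 0ℙ; 1ℙ)
open import Data.Fin using (Fin; zero; suc)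
open import Data.Product using (_×_; _,_)
open import Data.Sum using (_⊎_)
open import Function using (id)
open import Function.Bundles using (_⇔_; mk⇔; Equivalence)
open import Algebra.Bundles using (Monoid)
open import Relation.Nullary using (¬_)
open import Relation.Binary.PropositionalEquality
  using (_≡_; refl; sym; trans; cong; cong₂; subst; module ≡-Reasoning)
import Relation.Binary.Reasoning.Setoid as SetoidReasoning

private
  variable
    n : ℕ

wkᵀ : Term n → Term (suc n)
wkᵀ (var i) = var (suc i)
wkᵀ e       = e
wkᵀ (t ∘ s) = wkᵀ t ∘ wkᵀ s

wk : QF n → QF (suc n)
wk (t ≐ s)  = wkᵀ t ≐ wkᵀ s
wk (¬′ φ)   = ¬′ wk φ
wk (φ ∧′ ψ) = wk φ ∧′ wk ψ
wk (φ ∨′ ψ) = wk φ ∨′ wk ψ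

termSize-wkᵀ : (t : Term n) → termSize (wkᵀ t) ≡ termSize t
termSize-wkᵀ (var i) = refl
termSize-wkᵀ e       = refl
termSize-wkᵀ (t ∘ s) = cong₂ (λ a b → 1 + a + b) (termSize-wkᵀ t) (termSize-wkᵀ s)

qfSize-wk : (φ : QF n) → qfSize (wk φ) ≡ qfSize φ
qfSize-wk (t ≐ s)  = cong₂ (λ a b → 1 + a + b) (termSize-wkᵀ t) (termSize-wkᵀ s)
qfSize-wk (¬′ φ)   = cong suc (qfSize-wk φ)
qfSize-wk (φ ∧′ ψ) = cong₂ (λ a b → 1 + a + b) (qfSize-wk φ) (qfSize-wk ψ)
qfSize-wk (φ ∨′ ψ) = cong₂ (λ a b → 1 + a + b) (qfSize-wk φ) (qfSize-wk ψ)

-- The prenex form of (∃ȳ φ) ∧ ψ: ψ is conjoined to the matrix, weakened past ȳ.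
infixl 5 _∧ᵉ_
_∧ᵉ_ : ExFormula n → QF n → ExFormula n
qf φ ∧ᵉ ψ = qf (φ ∧′ ψ)
∃′ φ ∧ᵉ ψ = ∃′ (φ ∧ᵉ wk ψ)

size-∧ᵉ : (φ : ExFormula n) (ψ : QF n) → size (φ ∧ᵉ ψ) ≡ suc (size φ + qfSize ψ)
size-∧ᵉ (qf φ) ψ = refl
size-∧ᵉ (∃′ φ) ψ =
  cong (2 +_) (trans (size-∧ᵉ φ (wk ψ)) (cong (λ s → suc (size φ + s)) (qfSize-wk ψ)))

bitPowᵀ : Parity → Fin n → Term n
bitPowᵀ 0ℙ i = e
bitPowᵀ 1ℙ i = var i

bit : Parity → ℕ
bit 0ℙ = 0
bit 1ℙ = 1

2*⌊n/2⌋+bit≡n : ∀ m → 2 * ⌊ m /2⌋ + bit (parity m) ≡ m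
2*⌊n/2⌋+bit≡n zero          = refl
2*⌊n/2⌋+bit≡n (suc zero)    = refl
2*⌊n/2⌋+bit≡n (suc (suc m)) = trans
  (cong (λ k → suc k + bit (parity m)) (+-suc ⌊ m /2⌋ (⌊ m /2⌋ + 0)))
  (cong (2 +_) (2*⌊n/2⌋+bit≡n m))

⌊n/2⌋<2^k : ∀ {m} k → m < 2 ^ suc k → ⌊ m /2⌋ < 2 ^ k
⌊n/2⌋<2^k {m} k m<2^[1+k] = *-cancelˡ-< 2 ⌊ m /2⌋ (2 ^ k)
  (≤-<-trans (≤-trans (m≤m+n (2 * ⌊ m /2⌋) _) (≤-reflexive (2*⌊n/2⌋+bit≡n m))) m<2^[1+k])

halvingEq : Parity → Fin n → Fin n → QF (suc n)
halvingEq p g x = var (suc g) ≐ ((var zero ∘ var zero) ∘ bitPowᵀ p (suc x))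

qfSize-halvingEq : ∀ p (g x : Fin n) → qfSize (halvingEq p g x) ≡ 7
qfSize-halvingEq 0ℙ g x = refl
qfSize-halvingEq 1ℙ g x = refl

-- Defines xᵐ = g as long as m < 2ᵏ.
powerFormula : ℕ → ℕ → Fin n → Fin n → ExFormula n
powerFormula zero    m g x = qf (var g ≐ e)
powerFormula (suc k) m g x =
  ∃′ (powerFormula k ⌊ m /2⌋ zero (suc x) ∧ᵉ halvingEq (parity m) g x)

size-powerFormula : ∀ k m (g x : Fin n) → size (powerFormula k m g x) ≡ 3 + k * 10
size-powerFormula zero    m g x = refl
size-powerFormula (suc k) m g x = begin
  2 + size (powerFormula k ⌊ m /2⌋ zero (suc x) ∧ᵉ halvingEq (parity m) g x)
    ≡⟨ cong (2 +_) (size-∧ᵉ (powerFormula k ⌊ m /2⌋ zero (suc x)) (halvingEq (parity m) g x)) ⟩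
  3 + (size (powerFormula k ⌊ m /2⌋ zero (suc x)) + qfSize (halvingEq (parity m) g x))
    ≡⟨ cong₂ (λ a b → 3 + (a + b)) (size-powerFormula k ⌊ m /2⌋ zero (suc x))
                                   (qfSize-halvingEq (parity m) g x) ⟩
  6 + (k * 10 + 7)
    ≡⟨ cong (6 +_) (+-comm (k * 10) 7) ⟩
  3 + suc k * 10 ∎
  where open ≡-Reasoning

module _ {a ℓ} (M : Monoid a ℓ) where
  open Monoid M renaming (refl to ≈-refl; sym to ≈-sym)
  open Semantics M
  open SetoidReasoning setoid

  ⟦wkᵀ⟧ : (t : Term n) (y : Carrier) (ρ : Env n) → ⟦ wkᵀ t ⟧ (extend y ρ) ≡ ⟦ t ⟧ ρ
  ⟦wkᵀ⟧ (var i) y ρ = refl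
  ⟦wkᵀ⟧ e       y ρ = refl
  ⟦wkᵀ⟧ (t ∘ s) y ρ = cong₂ _∙_ (⟦wkᵀ⟧ t y ρ) (⟦wkᵀ⟧ s y ρ)

  SatQF-wk : (φ : QF n) (y : Carrier) (ρ : Env n) → SatQF (wk φ) (extend y ρ) ≡ SatQF φ ρ
  SatQF-wk (t ≐ s)  y ρ = cong₂ _≈_ (⟦wkᵀ⟧ t y ρ) (⟦wkᵀ⟧ s y ρ)
  SatQF-wk (¬′ φ)   y ρ = cong ¬_ (SatQF-wk φ y ρ)
  SatQF-wk (φ ∧′ ψ) y ρ = cong₂ _×_ (SatQF-wk φ y ρ) (SatQF-wk ψ y ρ)
  SatQF-wk (φ ∨′ ψ) y ρ = cong₂ _⊎_ (SatQF-wk φ y ρ) (SatQF-wk ψ y ρ)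

  Sat-∧ᵉ : (φ : ExFormula n) (ψ : QF n) (ρ : Env n) → Sat (φ ∧ᵉ ψ) ρ ⇔ (Sat φ ρ × SatQF ψ ρ)
  Sat-∧ᵉ (qf φ) ψ ρ = mk⇔ (λ (lift (s , t)) → lift s , t) (λ (lift s , t) → lift (s , t))
  Sat-∧ᵉ (∃′ φ) ψ ρ = mk⇔
    (λ (y , s) → let (sφ , sψ) = to (Sat-∧ᵉ φ (wk ψ) (extend y ρ)) s
                 in (y , sφ) , subst id (SatQF-wk ψ y ρ) sψ)
    (λ ((y , sφ) , sψ) → y , from (Sat-∧ᵉ φ (wk ψ) (extend y ρ)) (sφ , subst id (sym (SatQF-wk ψ y ρ)) sψ))
    where open Equivalence

  pow-+ : ∀ x m k → pow x (m + k) ≈ pow x m ∙ pow x k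
  pow-+ x zero    k = ≈-sym (identityˡ (pow x k))
  pow-+ x (suc m) k = begin
    x ∙ pow x (m + k)         ≈⟨ ∙-congˡ (pow-+ x m k) ⟩
    x ∙ (pow x m ∙ pow x k)   ≈⟨ ≈-sym (assoc x (pow x m) (pow x k)) ⟩
    (x ∙ pow x m) ∙ pow x k   ∎

  ⟦bitPowᵀ⟧ : ∀ p (i : Fin n) (ρ : Env n) → ⟦ bitPowᵀ p i ⟧ ρ ≈ pow (ρ i) (bit p)
  ⟦bitPowᵀ⟧ 0ℙ i ρ = ≈-refl
  ⟦bitPowᵀ⟧ 1ℙ i ρ = ≈-sym (identityʳ (ρ i))

  pow-halving : ∀ x m → pow x m ≈ (pow x ⌊ m /2⌋ ∙ pow x ⌊ m /2⌋) ∙ pow x (bit (parity m))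
  pow-halving x m = begin
    pow x m                                       ≡⟨ cong (pow x) (sym (2*⌊n/2⌋+bit≡n m)) ⟩
    pow x (2 * q + bit (parity m))                ≈⟨ pow-+ x (2 * q) _ ⟩
    pow x (q + (q + 0)) ∙ pow x (bit (parity m))  ≈⟨ ∙-congʳ (pow-+ x q (q + 0)) ⟩
    (pow x q ∙ pow x (q + 0)) ∙ pow x (bit (parity m))
      ≡⟨ cong (λ k → (pow x q ∙ pow x k) ∙ pow x (bit (parity m))) (+-identityʳ q) ⟩
    (pow x q ∙ pow x q) ∙ pow x (bit (parity m))  ∎
    where q = ⌊ m /2⌋

  Sat-powerFormula : ∀ k m (g x : Fin n) (ρ : Env n) → m < 2 ^ k →
                     Sat (powerFormula k m g x) ρ ⇔ (pow (ρ x) m ≈ ρ g)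
  Sat-powerFormula zero    zero g x ρ _ = mk⇔ (λ (lift g≈ε) → ≈-sym g≈ε) (λ ε≈g → lift (≈-sym ε≈g))
  Sat-powerFormula zero    (suc m) g x ρ (s≤s ())
  Sat-powerFormula (suc k) m    g x ρ m<2^[1+k] = mk⇔
    (λ (y , s) → let (sHalf , g≈yyxᵇ) = to (Sat-∧ᵉ φ ψ (extend y ρ)) s
                 in sound y (to (Sat-powerFormula k q zero (suc x) _ q<2^k) sHalf) g≈yyxᵇ)
    (λ xᵐ≈g → pow (ρ x) q , from (Sat-∧ᵉ φ ψ _)
                 (from (Sat-powerFormula k q zero (suc x) _ q<2^k) ≈-refl , complete xᵐ≈g))
    where
    open Equivalence
    q = ⌊ m /2⌋
    b = parity m
    φ = powerFormula k q zero (suc x)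
    ψ = halvingEq b g x
    q<2^k = ⌊n/2⌋<2^k k m<2^[1+k]

    sound : ∀ y → pow (ρ x) q ≈ y → SatQF ψ (extend y ρ) → pow (ρ x) m ≈ ρ g
    sound y xᵠ≈y g≈yyxᵇ = begin
      pow (ρ x) m                                   ≈⟨ pow-halving (ρ x) m ⟩
      (pow (ρ x) q ∙ pow (ρ x) q) ∙ pow (ρ x) (bit b)
        ≈⟨ ∙-cong (∙-cong xᵠ≈y xᵠ≈y) (≈-sym (⟦bitPowᵀ⟧ b (suc x) (extend y ρ))) ⟩
      (y ∙ y) ∙ ⟦ bitPowᵀ b (suc x) ⟧ (extend y ρ)  ≈⟨ ≈-sym g≈yyxᵇ ⟩
      ρ g                                           ∎

    complete : pow (ρ x) m ≈ ρ g → SatQF ψ (extend (pow (ρ x) q) ρ)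
    complete xᵐ≈g = begin
      ρ g                                              ≈⟨ ≈-sym xᵐ≈g ⟩
      pow (ρ x) m                                      ≈⟨ pow-halving (ρ x) m ⟩
      (pow (ρ x) q ∙ pow (ρ x) q) ∙ pow (ρ x) (bit b)
        ≈⟨ ∙-congˡ (≈-sym (⟦bitPowᵀ⟧ b (suc x) (extend (pow (ρ x) q) ρ))) ⟩
      (pow (ρ x) q ∙ pow (ρ x) q) ∙ ⟦ bitPowᵀ b (suc x) ⟧ (extend (pow (ρ x) q) ρ) ∎

n≤2^⌈log2⌉n : ∀ m (rec : Acc _<_ m) → m ≤ 2 ^ ⌈log2⌉ m rec
n≤2^⌈log2⌉n zero          _         = z≤n
n≤2^⌈log2⌉n (suc zero)    _         = s≤s z≤n
n≤2^⌈log2⌉n (suc (suc m)) (acc rec) = begin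
  2 + m                   ≡⟨ cong (2 +_) (sym (⌊n/2⌋+⌈n/2⌉≡n m)) ⟩
  2 + (⌊ m /2⌋ + ⌈ m /2⌉) ≤⟨ +-monoʳ-≤ 2 (+-monoˡ-≤ ⌈ m /2⌉ (⌊n/2⌋≤⌈n/2⌉ m)) ⟩
  2 + (⌈ m /2⌉ + ⌈ m /2⌉) ≡⟨ cong (λ c → 2 + (⌈ m /2⌉ + c)) (sym (+-identityʳ ⌈ m /2⌉)) ⟩
  2 + 2 * ⌈ m /2⌉         ≡⟨ sym (*-suc 2 ⌈ m /2⌉) ⟩
  2 * h                   ≤⟨ *-monoʳ-≤ 2 (n≤2^⌈log2⌉n h (rec (⌈n/2⌉<n m))) ⟩
  2 ^ ⌈log2⌉ (2 + m) (acc rec) ∎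
  where
  open ≤-Reasoning
  h = suc ⌈ m /2⌉

n<2^[1+⌈log₂n⌉] : ∀ m → m < 2 ^ suc ⌈log₂ m ⌉
n<2^[1+⌈log₂n⌉] m = ≤-<-trans (n≤2^⌈log2⌉n m (<-wellFounded m))
  (subst (2 ^ L <_) (*-comm (2 ^ L) 2) (m<m*n (2 ^ L) 2 {{m^n≢0 2 L}} ≤-refl))
  where L = ⌈log₂ m ⌉

m+i*n≤[m+n]*j : ∀ m n {i j} → i ≤ j → 1 ≤ j → m + i * n ≤ (m + n) * j
m+i*n≤[m+n]*j m n {i} {j} i≤j 1≤j = begin
  m + i * n     ≤⟨ +-mono-≤ (m≤m*n m j {{>-nonZero 1≤j}}) (*-monoˡ-≤ n i≤j) ⟩
  m * j + j * n ≡⟨ cong (m * j +_) (*-comm j n) ⟩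
  m * j + n * j ≡⟨ sym (*-distribʳ-+ j m n) ⟩
  (m + n) * j   ∎
  where open ≤-Reasoning

lemma2p1 : ∃-constant (λ c → (n : ℕ) → 1 ≤ n → GoodFormula c n)
lemma2p1 = 23 , λ m _ → record
  { θ          = powerFormula (depth m) m zero (suc zero)
  ; size-bound = subst (_≤ 23 * (1 ⊔ℕ ⌈log₂ m ⌉))
                   (sym (size-powerFormula (depth m) m zero (suc zero)))
                   (m+i*n≤[m+n]*j 13 10 (m≤n⊔m 1 ⌈log₂ m ⌉) (m≤m⊔n 1 ⌈log₂ m ⌉))
  ; defines    = λ M g x → Sat-powerFormula M (depth m) m zero (suc zero)
                   (Semantics.env₂ M g x) (n<2^[1+⌈log₂n⌉] m)
  }
  where
  depth : ℕ → ℕ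
  depth m = suc ⌈log₂ m ⌉
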